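{- Let the integers $T(n,k)$, for $n\ge 0$ and $0\le k\le n$, be defined by $T(0,0)=1$, $T(n,0)=1$ and $T(n,n)=0$ for $n>0$, and $T(n,k)=T(n,k-1)+T(n-1,k)$ for $n>1$, $0<k<n$. Then for every integer $n>0$, $$\sum_{k=0}^{n} T(n,k)\,2^{\,n-1-k}=\binom{2n-1}{n}.$$
   Context: The array $T(n,k)$ is the Catalan triangle. In the sum, the term with $k=n$ vanishes since $T(n,n)=0$ for $n>0$. -}

module Defs where

open import Data.Nat using (ℕ; zero; suc; _+_; _*_; _∸_; _^_; _<ᵇ_)
open import Data.Bool using (if_then_else_)

-- Catalan triangle T(n,k), 0 ≤ k ≤ n:
--   T(0,0)=1, T(n,0)=1 (n>0), T(n,n)=0 (n>0),
--   T(n,k) = T(n,k-1) + T(n-1,k) for 0<k<n.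
-- Values for k > n are irrelevant (set to 0).
T : ℕ → ℕ → ℕ
T zero    zero    = 1
T zero    (suc k) = 0
T (suc n) zero    = 1
T (suc n) (suc k) = if k <ᵇ n then T (suc n) k + T n (suc k) else 0

sumTo : ℕ → (ℕ → ℕ) → ℕ
sumTo zero    f = f 0
sumTo (suc n) f = sumTo n f + f (suc n)

-- T(n,k) is the ballot number C(n+k-1,k) − C(n+k-1,k-1).  Hence doubling the partial sum
-- Σ_{k≤j} T(n,k) 2^(j−k) and adding T(n,j+1) walks up Pascal's recurrence, so the partial sum
-- is the binomial C(n+j,j); at j = n−1 this is C(2n−1,n−1) = C(2n−1,n).
module Submission where

open import Defs
open import Data.Nat using (ℕ; zero; suc; _+_; _*_; _∸_; _^_; NonZero; _≤_; _<_; z≤n; s≤s; _<ᵇ_)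
open import Data.Nat.Combinatorics using (_C_; nCn≡1; nCk+nC[k+1]≡[n+1]C[k+1])
open import Data.Nat.Properties
import Algebra.Properties.CommutativeSemigroup as CommutativeSemigroupProperties
open CommutativeSemigroupProperties +-commutativeSemigroup using (xy∙z≈xz∙y; xy∙z≈x∙zy)
open CommutativeSemigroupProperties *-commutativeSemigroup using () renaming (x∙yz≈y∙xz to *-x∙yz≈y∙xz)
open import Data.Bool using (false)
open import Data.Bool.Properties using (T-≡)
open import Data.Sum using (inj₁; inj₂)
open import Function.Bundles using (Equivalence)
open import Relation.Binary.PropositionalEquality

-- Monotone lattice paths from (0,0) to (a,b): Pascal's triangle in symmetric coordinates.
paths : ℕ → ℕ → ℕ
paths zero    b       = 1
paths (suc a) zero    = 1
paths (suc a) (suc b) = paths a (suc b) + paths (suc a) b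

paths-sym : ∀ a b → paths a b ≡ paths b a
paths-sym zero    zero    = refl
paths-sym zero    (suc b) = refl
paths-sym (suc a) zero    = refl
paths-sym (suc a) (suc b) = begin
  paths a (suc b) + paths (suc a) b ≡⟨ cong₂ _+_ (paths-sym a (suc b)) (paths-sym (suc a) b) ⟩
  paths (suc b) a + paths b (suc a) ≡⟨ +-comm (paths (suc b) a) _ ⟩
  paths b (suc a) + paths (suc b) a ∎
  where open ≡-Reasoning

paths≡C : ∀ a b → paths a b ≡ (a + b) C b
paths≡C zero    b       = sym (nCn≡1 b)
paths≡C (suc a) zero    = refl
paths≡C (suc a) (suc b) = begin
  paths a (suc b) + paths (suc a) b         ≡⟨ cong₂ _+_ (paths≡C a (suc b)) (paths≡C (suc a) b) ⟩
  (a + suc b) C suc b + (suc a + b) C b     ≡⟨ cong (λ x → (a + suc b) C suc b + x C b) (sym (+-suc a b)) ⟩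
  (a + suc b) C suc b + (a + suc b) C b     ≡⟨ +-comm ((a + suc b) C suc b) _ ⟩
  (a + suc b) C b + (a + suc b) C suc b     ≡⟨ nCk+nC[k+1]≡[n+1]C[k+1] (a + suc b) b ⟩
  suc (a + suc b) C suc b                   ∎
  where open ≡-Reasoning

T-step : ∀ {m k} → k < m → T (suc m) (suc k) ≡ T (suc m) k + T m (suc k)
T-step k<m rewrite Equivalence.to T-≡ (<⇒<ᵇ k<m) = refl

<ᵇ-irrefl : ∀ m → (m <ᵇ m) ≡ false
<ᵇ-irrefl zero    = refl
<ᵇ-irrefl (suc m) = <ᵇ-irrefl m

T-diagonal : ∀ m → T (suc m) (suc m) ≡ 0
T-diagonal m rewrite <ᵇ-irrefl m = refl

-- Pascal's recurrences for paths and for T differ only in the term T(m,j+1), which is why the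
-- identity propagates; on the diagonal T vanishes and the identity is symmetry of paths.
T+paths≡paths : ∀ m j → j ≤ m → T (suc m) (suc j) + paths j (suc m) ≡ paths (suc j) m
T+paths≡2*paths : ∀ m j → j ≤ m → T (suc m) j + paths j (suc m) ≡ paths j m + paths j m

T+paths≡paths m j j≤m with m≤n⇒m<n∨m≡n j≤m
... | inj₂ refl = trans (cong (_+ paths m (suc m)) (T-diagonal m)) (paths-sym m (suc m))
T+paths≡paths (suc m) j _ | inj₁ j<1+m@(s≤s j≤m) = begin
  T (suc (suc m)) (suc j) + paths j (suc (suc m))
    ≡⟨ cong (_+ paths j (suc (suc m))) (T-step j<1+m) ⟩
  (T (suc (suc m)) j + T (suc m) (suc j)) + paths j (suc (suc m))
    ≡⟨ xy∙z≈xz∙y (T (suc (suc m)) j) _ _ ⟩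
  (T (suc (suc m)) j + paths j (suc (suc m))) + T (suc m) (suc j)
    ≡⟨ cong (_+ T (suc m) (suc j)) (T+paths≡2*paths (suc m) j (m≤n⇒m≤1+n j≤m)) ⟩
  (paths j (suc m) + paths j (suc m)) + T (suc m) (suc j)
    ≡⟨ xy∙z≈x∙zy (paths j (suc m)) _ _ ⟩
  paths j (suc m) + (T (suc m) (suc j) + paths j (suc m))
    ≡⟨ cong (paths j (suc m) +_) (T+paths≡paths m j j≤m) ⟩
  paths j (suc m) + paths (suc j) m ∎
  where open ≡-Reasoning

T+paths≡2*paths m       zero    _       = refl
T+paths≡2*paths (suc m) (suc j) (s≤s j≤m) = begin
  T (suc (suc m)) (suc j) + (paths j (suc (suc m)) + paths (suc j) (suc m))
    ≡⟨ sym (+-assoc (T (suc (suc m)) (suc j)) _ _) ⟩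
  (T (suc (suc m)) (suc j) + paths j (suc (suc m))) + paths (suc j) (suc m)
    ≡⟨ cong (_+ paths (suc j) (suc m)) (T+paths≡paths (suc m) j (m≤n⇒m≤1+n j≤m)) ⟩
  paths (suc j) (suc m) + paths (suc j) (suc m) ∎
  where open ≡-Reasoning

sumTo-cong : ∀ j {f g : ℕ → ℕ} → (∀ {k} → k ≤ j → f k ≡ g k) → sumTo j f ≡ sumTo j g
sumTo-cong zero    f≗g = f≗g z≤n
sumTo-cong (suc j) f≗g = cong₂ _+_ (sumTo-cong j (λ k≤j → f≗g (m≤n⇒m≤1+n k≤j))) (f≗g ≤-refl)

*-distribˡ-sumTo : ∀ c j (f : ℕ → ℕ) → sumTo j (λ k → c * f k) ≡ c * sumTo j f
*-distribˡ-sumTo c zero    f = refl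
*-distribˡ-sumTo c (suc j) f = begin
  sumTo j (λ k → c * f k) + c * f (suc j) ≡⟨ cong (_+ c * f (suc j)) (*-distribˡ-sumTo c j f) ⟩
  c * sumTo j f + c * f (suc j)           ≡⟨ *-distribˡ-+ c (sumTo j f) (f (suc j)) ⟨
  c * (sumTo j f + f (suc j))             ∎
  where open ≡-Reasoning

sumTo-horner : ∀ b j (f : ℕ → ℕ) →
  sumTo (suc j) (λ k → f k * b ^ (suc j ∸ k)) ≡ b * sumTo j (λ k → f k * b ^ (j ∸ k)) + f (suc j)
sumTo-horner b j f = cong₂ _+_ shifted last
  where
  shifted : sumTo j (λ k → f k * b ^ (suc j ∸ k)) ≡ b * sumTo j (λ k → f k * b ^ (j ∸ k))
  shifted = trans (sumTo-cong j (λ {k} k≤j →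
                     trans (cong (λ e → f k * b ^ e) (+-∸-assoc 1 k≤j)) (*-x∙yz≈y∙xz (f k) b _)))
                  (*-distribˡ-sumTo b j (λ k → f k * b ^ (j ∸ k)))
  last : f (suc j) * b ^ (j ∸ j) ≡ f (suc j)
  last = trans (cong (λ e → f (suc j) * b ^ e) (n∸n≡0 j)) (*-identityʳ (f (suc j)))

partialRowSum≡paths : ∀ m j → j ≤ m → sumTo j (λ k → T (suc m) k * 2 ^ (j ∸ k)) ≡ paths j (suc m)
partialRowSum≡paths m zero    _   = refl
partialRowSum≡paths m (suc j) j<m = begin
  sumTo (suc j) (λ k → T (suc m) k * 2 ^ (suc j ∸ k))
    ≡⟨ sumTo-horner 2 j (T (suc m)) ⟩
  2 * sumTo j (λ k → T (suc m) k * 2 ^ (j ∸ k)) + T (suc m) (suc j)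
    ≡⟨ cong (λ s → 2 * s + T (suc m) (suc j)) (partialRowSum≡paths m j (<⇒≤ j<m)) ⟩
  2 * paths j (suc m) + T (suc m) (suc j)
    ≡⟨ cong (_+ T (suc m) (suc j)) (cong (paths j (suc m) +_) (+-identityʳ _)) ⟩
  (paths j (suc m) + paths j (suc m)) + T (suc m) (suc j)
    ≡⟨ xy∙z≈x∙zy (paths j (suc m)) _ _ ⟩
  paths j (suc m) + (T (suc m) (suc j) + paths j (suc m))
    ≡⟨ cong (paths j (suc m) +_) (T+paths≡paths m j (<⇒≤ j<m)) ⟩
  paths (suc j) (suc m) ∎
  where open ≡-Reasoning

theorem2 : (n : ℕ) → .{{_ : NonZero n}} →
    sumTo n (λ k → T n k * 2 ^ (n ∸ 1 ∸ k)) ≡ (2 * n ∸ 1) C n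
theorem2 (suc m) = begin
  sumTo m (λ k → T (suc m) k * 2 ^ (m ∸ k)) + T (suc m) (suc m) * 2 ^ (m ∸ suc m)
    ≡⟨ cong (λ t → sumTo m (λ k → T (suc m) k * 2 ^ (m ∸ k)) + t * 2 ^ (m ∸ suc m)) (T-diagonal m) ⟩
  sumTo m (λ k → T (suc m) k * 2 ^ (m ∸ k)) + 0
    ≡⟨ +-identityʳ _ ⟩
  sumTo m (λ k → T (suc m) k * 2 ^ (m ∸ k))
    ≡⟨ partialRowSum≡paths m m ≤-refl ⟩
  paths m (suc m)
    ≡⟨ paths≡C m (suc m) ⟩
  (m + suc m) C suc m
    ≡⟨ cong (λ k → (m + suc k) C suc m) (+-identityʳ m) ⟨
  (2 * suc m ∸ 1) C suc m ∎
  where open ≡-Reasoning
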